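{- Let $A$ and $M$ be infinite sets of positive integers, and let $p_{A,M}(n)$ denote the number of partitions of $n$ with parts in $A$ and multiplicities in $M$. Suppose there exist $c > 0$ and $x_0$ such that $A(x) \geq c \log x$ for all $x \geq x_0$, where $A(x) = \#\{b \in A : b \leq x\}$. Then for every positive integer $k$ there exist infinitely many positive integers $n$ such that $p_{A,M}(n) \geq n^k$. In particular, $p_{A,M}$ is weakly superpolynomial.
   Context: For nonempty sets $A, M$ of positive integers, a partition of $n$ with parts in $A$ and multiplicities in $M$ is a representation $n = \sum_{b \in A} m_b b$ where $m_b \in M \cup \{0\}$ for all $b \in A$ and $m_b \in M$ for only finitely many $b$; $p_{A,M}(n)$ is the number of such partitions. An arithmetic function $f$ is weakly superpolynomial if it does not have polynomial growth, i.e. for every positive integer $k$ there are infinitely many positive integers $n$ with $f(n) > n^k$. Here $\log$ is the natural logarithm. -}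

module Defs where

open import Data.Nat using (ℕ; zero; suc; _+_; _*_; _^_; _≤_; _<_)
open import Data.Fin using (Fin)
open import Data.Product using (Σ; ∃; _×_; _,_)
open import Data.Sum using (_⊎_)
open import Relation.Binary.PropositionalEquality using (_≡_)
open import Relation.Unary using (Pred)
open import Level using (0ℓ)

PositiveSet : Pred ℕ 0ℓ → Set
PositiveSet S = ∀ b → S b → 0 < b

Infinite : Pred ℕ 0ℓ → Set
Infinite S = ∀ x → ∃ λ b → x < b × S b

sumUpTo : (ℕ → ℕ) → ℕ → ℕ
sumUpTo f zero = f zero
sumUpTo f (suc n) = sumUpTo f n + f (suc n)

-- Since every part b with m_b ≥ 1 satisfies
-- b ≤ n, the support lies in [0, n] and the sum is taken over b ≤ n.
record Partition (A M : Pred ℕ 0ℓ) (n : ℕ) : Set where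
  field
    mult    : ℕ → ℕ
    allowed : ∀ b → mult b ≡ 0 ⊎ (A b × M (mult b))
    support : ∀ b → n < b → mult b ≡ 0
    total   : sumUpTo (λ b → mult b * b) n ≡ n
open Partition public

SamePartition : ∀ {A M n} → Partition A M n → Partition A M n → Set
SamePartition P Q = ∀ b → mult P b ≡ mult Q b

PartitionsAtLeast : Pred ℕ 0ℓ → Pred ℕ 0ℓ → ℕ → ℕ → Set
PartitionsAtLeast A M n N =
  Σ (Fin N → Partition A M n) λ f → ∀ i j → SamePartition (f i) (f j) → i ≡ j

CountAtLeast : Pred ℕ 0ℓ → ℕ → ℕ → Set
CountAtLeast A x m =
  Σ (Fin m → ℕ) λ f → (∀ i j → f i ≡ f j → i ≡ j) × (∀ i → A (f i) × f i ≤ x)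

-- Logarithmic lower bound: ∃ c > 0, x₀ with A(x) ≥ c log x for x ≥ x₀.
-- Rendered without reals as: ∃ a ≥ 1, x₀ such that for all x ≥ x₀,
-- x ≤ 2 ^ (a * A(x))  (equivalent).
LogLowerBound : Pred ℕ 0ℓ → Set
LogLowerBound A =
  ∃ λ a → 1 ≤ a × ∃ λ x₀ → ∀ x → x₀ ≤ x →
    ∃ λ m → CountAtLeast A x m × x ≤ 2 ^ (a * m)

{-# OPTIONS --safe #-}
-- Take t = 2^((k+1)(a+1)+1) distinct multiplicities in M, all above N and at most z.
-- For x ≥ (2 z^(k+1))^a the logarithmic density of A provides r distinct parts
-- b₁, …, b_r ≤ x in A with x ≤ 2^(ar), whence 2 z^(k+1) ≤ 2^r.  Each of the t^r ways
-- of assigning one of the multiplicities to every part gives its own partition, whose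
-- size lies in (N, L] with L = r z x.  By pigeonhole some size n ≤ L is shared by
-- t^r / (L+1) ≥ L^k ≥ n^k of them, since, using r < 2^r,
--   (L+1) L^k ≤ 2 L^(k+1) = 2 z^(k+1) (r x)^(k+1) ≤ 2^r (2^r 2^(ar))^(k+1) = t^r.
module Submission where

open import Defs
open import Level using (0ℓ)
open import Data.Nat using (ℕ; zero; suc; _+_; _*_; _^_; _≤_; _<_; z≤n; s≤s; NonZero; >-nonZero; >-nonZero⁻¹)
open import Data.Nat.Properties
open import Data.Nat.Tactic.RingSolver using (solve-∀)
open import Data.Fin using (Fin; zero; suc; toℕ; fromℕ<; punchIn; inject≤; combine; finToFun; funToFin)
open import Data.Fin.Properties using (any?; funToFin-finToFin; toℕ≤pred[n]; inject≤-injective; toℕ-injective; toℕ-fromℕ<; toℕ-inject₁; toℕ-fromℕ; punchInᵢ≢i)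
open import Data.Vec.Functional using (init; last)
open import Data.List using (List; []; _∷_; length; lookup; filter; allFin)
open import Data.List.Properties using (length-tabulate; filter-accept; filter-reject)
open import Data.List.Relation.Unary.All as All using (All; []; _∷_)
open import Data.List.Relation.Unary.All.Properties using (all-filter)
open import Data.List.Relation.Unary.AllPairs using (_∷_)
open import Data.List.Relation.Unary.Unique.Propositional using (Unique)
import Data.List.Relation.Unary.Unique.Propositional.Properties as Unique
open import Data.List.Membership.Propositional.Properties using (∈-lookup)
open import Data.Product using (Σ; ∃; _×_; _,_; proj₁; proj₂)
open import Data.Sum using (_⊎_; inj₁; inj₂)
open import Function.Base using (_∘_; id)
open import Function.Definitions using (Injective)
open import Relation.Binary.PropositionalEquality
open import Relation.Nullary using (Dec; yes; no; contradiction)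
open import Relation.Unary using (Pred)
open import Algebra.Properties.Semiring.Sum +-*-semiring
open import Algebra.Properties.CommutativeSemigroup *-commutativeSemigroup using (x∙yz≈y∙xz)

δ : ℕ → ℕ → ℕ
δ a b with a ≟ b
... | yes _ = 1
... | no  _ = 0

δ-≡ : ∀ {a b} → a ≡ b → δ a b ≡ 1
δ-≡ {a} {b} a≡b with a ≟ b
... | yes _   = refl
... | no  a≢b = contradiction a≡b a≢b

δ-≢ : ∀ {a b} → a ≢ b → δ a b ≡ 0
δ-≢ {a} {b} a≢b with a ≟ b
... | yes a≡b = contradiction a≡b a≢b
... | no  _   = refl

δ-comm : ∀ a b → δ a b ≡ δ b a
δ-comm a b with a ≟ b | b ≟ a
... | yes _   | yes _   = refl
... | yes a≡b | no  b≢a = contradiction (sym a≡b) b≢a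
... | no  a≢b | yes b≡a = contradiction (sym b≡a) a≢b
... | no  _   | no  _   = refl

∑-δ : ∀ {m} (e : Fin m → ℕ) → Injective _≡_ _≡_ e → ∀ {c} i → e i ≡ c → (g : Fin m → ℕ) →
      ∑[ j < m ] (δ (e j) c * g j) ≡ g i
∑-δ {suc m} e e-inj {c} i refl g = begin
  ∑[ j < suc m ] (δ (e j) c * g j)                    ≡⟨ sum-remove {i = i} (λ j → δ (e j) c * g j) ⟩
  δ c c * g i + ∑[ j < m ] (δ (e (punchIn i j)) c * g (punchIn i j))
    ≡⟨ cong₂ _+_ (trans (cong (_* g i) (δ-≡ {c} refl)) (*-identityˡ (g i))) (sum-cong-≗ others-vanish) ⟩
  g i + ∑[ j < m ] 0                                  ≡⟨ cong (g i +_) (sum-replicate-zero m) ⟩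
  g i + 0                                             ≡⟨ +-identityʳ (g i) ⟩
  g i ∎
  where
  open ≡-Reasoning
  others-vanish : ∀ j → δ (e (punchIn i j)) c * g (punchIn i j) ≡ 0
  others-vanish j = cong (_* g (punchIn i j)) (δ-≢ (punchInᵢ≢i i j ∘ e-inj))

≤-sum : ∀ {m} (f : Fin m → ℕ) i → f i ≤ sum f
≤-sum {suc m} f i = ≤-trans (m≤m+n (f i) _) (≤-reflexive (sym (sum-remove {i = i} f)))

sum-≤-* : ∀ {m} (f : Fin m → ℕ) {B} → (∀ i → f i ≤ B) → sum f ≤ m * B
sum-≤-* {zero}  f f≤B = z≤n
sum-≤-* {suc m} f f≤B = +-mono-≤ (f≤B zero) (sum-≤-* (f ∘ suc) (f≤B ∘ suc))

sum-<-* : ∀ {m} (f : Fin (suc m) → ℕ) {B} → (∀ i → f i < B) → sum f < suc m * B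
sum-<-* f f<B = +-mono-<-≤ (f<B zero) (sum-≤-* (f ∘ suc) (<⇒≤ ∘ f<B ∘ suc))

sumUpTo≡∑ : ∀ f n → sumUpTo f n ≡ ∑[ i ≤ n ] f (toℕ i)
sumUpTo≡∑ f zero    = sym (+-identityʳ (f 0))
sumUpTo≡∑ f (suc n) = begin
  sumUpTo f n + f (suc n)
    ≡⟨ cong₂ _+_ (trans (sumUpTo≡∑ f n) (sum-cong-≗ {suc n} (cong f ∘ sym ∘ toℕ-inject₁)))
                 (cong f (sym (toℕ-fromℕ (suc n)))) ⟩
  sum (init t) + last t ≡⟨ sym (sum-init-last t) ⟩
  sum t ∎
  where
  open ≡-Reasoning
  t : Fin (suc (suc n)) → ℕ
  t i = f (toℕ i)

module FiniteSupport {A M : Pred ℕ 0ℓ} (M-positive : PositiveSet M)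
  {r} (parts : Fin r → ℕ) (parts-injective : Injective _≡_ _≡_ parts) (parts∈A : ∀ j → A (parts j))
  where

  -- A δ-sum, so that the size of the partition is computed by exchanging two finite sums.
  multiplicity : (Fin r → ℕ) → ℕ → ℕ
  multiplicity w b = ∑[ j < r ] (δ (parts j) b * w j)

  size : (Fin r → ℕ) → ℕ
  size w = ∑[ j < r ] (w j * parts j)

  multiplicity-parts : ∀ w i → multiplicity w (parts i) ≡ w i
  multiplicity-parts w i = ∑-δ parts parts-injective i refl w

  multiplicity-outside : ∀ w {b} → (∀ j → parts j ≢ b) → multiplicity w b ≡ 0
  multiplicity-outside w {b} b∉parts =
    trans (sum-cong-≗ (λ j → cong (_* w j) (δ-≢ (b∉parts j)))) (sum-replicate-zero r)

  parts≤size : ∀ {w} → (∀ j → M (w j)) → ∀ j → parts j ≤ size w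
  parts≤size {w} w∈M j = ≤-trans (m≤n*m (parts j) (w j) {{>-nonZero (M-positive _ (w∈M j))}})
                                 (≤-sum (λ j → w j * parts j) j)

  sumUpTo-multiplicity : ∀ w n → (∀ j → parts j ≤ n) →
                         sumUpTo (λ b → multiplicity w b * b) n ≡ size w
  sumUpTo-multiplicity w n parts≤n = begin
    sumUpTo (λ b → multiplicity w b * b) n
      ≡⟨ sumUpTo≡∑ _ n ⟩
    ∑[ i ≤ n ] (multiplicity w (toℕ i) * toℕ i)
      ≡⟨ sum-cong-≗ {suc n} (λ i → trans (*-distribʳ-sum (toℕ i) (λ j → δ (parts j) (toℕ i) * w j))
                                         (sum-cong-≗ {r} (reassociate i))) ⟩
    ∑[ i ≤ n ] ∑[ j < r ] (δ (toℕ i) (parts j) * (w j * toℕ i))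
      ≡⟨ ∑-comm {suc n} (λ i j → δ (toℕ i) (parts j) * (w j * toℕ i)) ⟩
    ∑[ j < r ] ∑[ i ≤ n ] (δ (toℕ i) (parts j) * (w j * toℕ i))
      ≡⟨ sum-cong-≗ (λ j → ∑-δ toℕ toℕ-injective (fromℕ< (s≤s (parts≤n j))) (toℕ-fromℕ< _)
                                (λ i → w j * toℕ i)) ⟩
    ∑[ j < r ] (w j * toℕ (fromℕ< (s≤s (parts≤n j))))
      ≡⟨ sum-cong-≗ (λ j → cong (w j *_) (toℕ-fromℕ< _)) ⟩
    size w ∎
    where
    open ≡-Reasoning
    reassociate : ∀ i j → δ (parts j) (toℕ i) * w j * toℕ i ≡ δ (toℕ i) (parts j) * (w j * toℕ i)
    reassociate i j = trans (*-assoc (δ (parts j) (toℕ i)) (w j) (toℕ i))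
                            (cong (_* (w j * toℕ i)) (δ-comm (parts j) (toℕ i)))

  weight≤size : PositiveSet A → ∀ w j → w j ≤ size w
  weight≤size A-positive w j = ≤-trans (m≤m*n (w j) (parts j) {{>-nonZero (A-positive _ (parts∈A j))}})
                                       (≤-sum (λ j → w j * parts j) j)

  size-≤ : ∀ w {B x} → (∀ j → w j ≤ B) → (∀ j → parts j ≤ x) → size w ≤ r * (B * x)
  size-≤ w w≤B parts≤x = sum-≤-* (λ j → w j * parts j) (λ j → *-mono-≤ (w≤B j) (parts≤x j))

  partition : (w : Fin r → ℕ) → (∀ j → M (w j)) → ∀ {n} → size w ≡ n → Partition A M n
  partition w w∈M {n} size≡n = record
    { mult    = multiplicity w
    ; allowed = allowed′
    ; support = λ b n<b → multiplicity-outside w (λ j j≡b → <⇒≱ n<b (subst (_≤ n) j≡b (parts≤n j)))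
    ; total   = trans (sumUpTo-multiplicity w n parts≤n) size≡n
    }
    where
    parts≤n : ∀ j → parts j ≤ n
    parts≤n j = subst (parts j ≤_) size≡n (parts≤size w∈M j)
    allowed′ : ∀ b → multiplicity w b ≡ 0 ⊎ (A b × M (multiplicity w b))
    allowed′ b with any? (λ j → parts j ≟ b)
    ... | yes (j , refl) = inj₂ (parts∈A j , subst M (sym (multiplicity-parts w j)) (w∈M j))
    ... | no  b∉parts    = inj₁ (multiplicity-outside w (λ j j≡b → b∉parts (j , j≡b)))

lookup-injective : ∀ {X : Set} {xs : List X} → Unique xs → Injective _≡_ _≡_ (lookup xs)
lookup-injective (_ ∷ _)           {zero}  {zero}  _ = refl
lookup-injective (x∉xs ∷ _)        {zero}  {suc j} x≡ = contradiction x≡ (All.lookup x∉xs (∈-lookup j))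
lookup-injective (x∉xs ∷ _)        {suc i} {zero}  ≡x = contradiction (sym ≡x) (All.lookup x∉xs (∈-lookup i))
lookup-injective (_ ∷ xs-unique)   {suc i} {suc j} eq = cong suc (lookup-injective xs-unique eq)

module _ {X : Set} (s : X → ℕ) where

  fibre : ℕ → List X → List X
  fibre n = filter (λ x → n ≟ s x)

  length-fibre-∷ : ∀ n x xs → length (fibre n (x ∷ xs)) ≡ δ n (s x) + length (fibre n xs)
  length-fibre-∷ n x xs = by-cases (n ≟ s x)
    where
    by-cases : Dec (n ≡ s x) → length (fibre n (x ∷ xs)) ≡ δ n (s x) + length (fibre n xs)
    by-cases (yes n≡sx) = trans (cong length (filter-accept (λ y → n ≟ s y) n≡sx))
                                (cong (_+ _) (sym (δ-≡ n≡sx)))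
    by-cases (no  n≢sx) = trans (cong length (filter-reject (λ y → n ≟ s y) n≢sx))
                                (cong (_+ _) (sym (δ-≢ n≢sx)))

  ∑-length-fibre : ∀ L xs → All (λ x → s x ≤ L) xs →
                   ∑[ n ≤ L ] length (fibre (toℕ n) xs) ≡ length xs
  ∑-length-fibre L []       []             = sum-replicate-zero (suc L)
  ∑-length-fibre L (x ∷ xs) (sx≤L ∷ xs≤L) = begin
    ∑[ n ≤ L ] length (fibre (toℕ n) (x ∷ xs))
      ≡⟨ sum-cong-≗ {suc L} (λ n → length-fibre-∷ (toℕ n) x xs) ⟩
    ∑[ n ≤ L ] (δ (toℕ n) (s x) + length (fibre (toℕ n) xs))
      ≡⟨ ∑-distrib-+ {suc L} (λ n → δ (toℕ n) (s x)) (λ n → length (fibre (toℕ n) xs)) ⟩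
    ∑[ n ≤ L ] δ (toℕ n) (s x) + ∑[ n ≤ L ] length (fibre (toℕ n) xs)
      ≡⟨ cong₂ _+_ hits-once (∑-length-fibre L xs xs≤L) ⟩
    suc (length xs) ∎
    where
    open ≡-Reasoning
    hits-once : ∑[ n ≤ L ] δ (toℕ n) (s x) ≡ 1
    hits-once = trans (sum-cong-≗ {suc L} (λ n → sym (*-identityʳ (δ (toℕ n) (s x)))))
                      (∑-δ toℕ toℕ-injective (fromℕ< (s≤s sx≤L)) (toℕ-fromℕ< _) (λ _ → 1))

  large-fibre : ∀ L K xs → All (λ x → s x ≤ L) xs → suc L * K ≤ length xs →
                ∃ λ n → n ≤ L × K ≤ length (fibre n xs)
  large-fibre L K xs xs≤L L*K≤ with any? (λ (n : Fin (suc L)) → K ≤? length (fibre (toℕ n) xs))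
  ... | yes (n , K≤) = toℕ n , toℕ≤pred[n] n , K≤
  ... | no  all-small = contradiction (∑-length-fibre L xs xs≤L) (<⇒≢ (<-≤-trans sum<L*K L*K≤))
    where
    sum<L*K : ∑[ n ≤ L ] length (fibre (toℕ n) xs) < suc L * K
    sum<L*K = sum-<-* (λ n → length (fibre (toℕ n) xs)) (λ n → ≰⇒> (λ K≤ → all-small (n , K≤)))

pigeonhole : ∀ {T} (s : Fin T → ℕ) L K → (∀ c → s c ≤ L) → suc L * K ≤ T →
             ∃ λ n → n ≤ L × Σ (Fin K → Fin T) λ f → Injective _≡_ _≡_ f × (∀ i → s (f i) ≡ n)
pigeonhole {T} s L K s≤L L*K≤T with large-fibre s L K (allFin T) (All.universal s≤L (allFin T))
                                         (subst (suc L * K ≤_) (sym (length-tabulate id)) L*K≤T)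
... | n , n≤L , K≤ = n , n≤L , f , f-injective , f-in-fibre
  where
  index : Fin K → Fin (length (fibre s n (allFin T)))
  index i = inject≤ i K≤
  f : Fin K → Fin T
  f = lookup (fibre s n (allFin T)) ∘ index
  f-injective : Injective _≡_ _≡_ f
  f-injective = inject≤-injective K≤ K≤ _ _ ∘ lookup-injective (Unique.filter⁺ _ (Unique.allFin⁺ T))
  f-in-fibre : ∀ i → s (f i) ≡ n
  f-in-fibre i = sym (All.lookup (all-filter _ (allFin T)) (∈-lookup (index i)))

funToFin-cong : ∀ {m n} {f g : Fin m → Fin n} → f ≗ g → funToFin f ≡ funToFin g
funToFin-cong {zero}  _   = refl
funToFin-cong {suc m} f≗g = cong₂ combine (f≗g zero) (funToFin-cong (f≗g ∘ suc))

finToFun-injective : ∀ {m n} {c c′ : Fin (m ^ n)} → finToFun {m} {n} c ≗ finToFun c′ → c ≡ c′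
finToFun-injective {m} {n} {c} {c′} eq =
  trans (sym (funToFin-finToFin {n} {m} c)) (trans (funToFin-cong eq) (funToFin-finToFin {n} {m} c′))

PartitionsAtLeast-≤ : ∀ {A M n K K′} → K′ ≤ K →
                      PartitionsAtLeast A M n K → PartitionsAtLeast A M n K′
PartitionsAtLeast-≤ K′≤K (f , f-injective) =
  (λ i → f (inject≤ i K′≤K)) ,
  λ i j same → inject≤-injective K′≤K K′≤K i j (f-injective _ _ same)

distinct-elements-above : ∀ {S : Pred ℕ 0ℓ} → Infinite S → ∀ N t →
  ∃ λ z → N < z × Σ (Fin t → ℕ) λ m →
    Injective _≡_ _≡_ m × (∀ i → S (m i) × N < m i × m i ≤ z)
distinct-elements-above S-infinite N zero = suc N , ≤-refl , (λ ()) , (λ { {()} }) , λ ()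
distinct-elements-above {S} S-infinite N (suc t) with distinct-elements-above S-infinite N t
... | z , N<z , m , m-injective , m-bounds with S-infinite z
... | b , z<b , b∈S = b , <-trans N<z z<b , m′ , m′-injective , m′-bounds
  where
  m′ : Fin (suc t) → ℕ
  m′ zero    = b
  m′ (suc i) = m i
  b≢m : ∀ i → b ≢ m i
  b≢m i b≡mi = <⇒≱ z<b (subst (_≤ z) (sym b≡mi) (proj₂ (proj₂ (m-bounds i))))
  m′-injective : Injective _≡_ _≡_ m′
  m′-injective {zero}  {zero}  _  = refl
  m′-injective {zero}  {suc j} eq = contradiction eq (b≢m j)
  m′-injective {suc i} {zero}  eq = contradiction (sym eq) (b≢m i)
  m′-injective {suc i} {suc j} eq = cong suc (m-injective eq)
  m′-bounds : ∀ i → S (m′ i) × N < m′ i × m′ i ≤ b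
  m′-bounds zero    = b∈S , <-trans N<z z<b , ≤-refl
  m′-bounds (suc i) with m-bounds i
  ... | mi∈S , N<mi , mi≤z = mi∈S , N<mi , ≤-trans mi≤z (<⇒≤ z<b)

^-distribʳ-* : ∀ m n o → (m * n) ^ o ≡ m ^ o * n ^ o
^-distribʳ-* m n zero    = refl
^-distribʳ-* m n (suc o) = trans (cong (m * n *_) (^-distribʳ-* m n o)) (interchange m n (m ^ o) (n ^ o))
  where
  interchange : ∀ a b c d → a * b * (c * d) ≡ a * c * (b * d)
  interchange = solve-∀

n<2^n : ∀ n → n < 2 ^ n
n<2^n zero    = s≤s z≤n
n<2^n (suc n) = +-mono-≤-< (m^n>0 2 n) (subst (n <_) (sym (+-identityʳ (2 ^ n))) (n<2^n n))

^-cancelˡ-≤ : ∀ a .{{_ : NonZero a}} {u v} → u ^ a ≤ v ^ a → u ≤ v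
^-cancelˡ-≤ a {u} {v} uᵃ≤vᵃ with u ≤? v
... | yes u≤v = u≤v
... | no  u≰v = contradiction uᵃ≤vᵃ (<⇒≱ (^-monoˡ-< a (≰⇒> u≰v)))

suc-*-^≤2*-^ : ∀ L k → 1 ≤ L → suc L * L ^ k ≤ 2 * L ^ suc k
suc-*-^≤2*-^ L k 1≤L = begin
  suc L * L ^ k   ≡⟨ cong (_* L ^ k) (+-comm 1 L) ⟩
  (L + 1) * L ^ k ≤⟨ *-monoˡ-≤ (L ^ k) (+-monoʳ-≤ L 1≤L) ⟩
  (L + L) * L ^ k ≡⟨ cong (λ y → (L + y) * L ^ k) (sym (+-identityʳ L)) ⟩
  2 * L * L ^ k   ≡⟨ *-assoc 2 L (L ^ k) ⟩
  2 * L ^ suc k ∎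
  where open ≤-Reasoning

configurations-outnumber : ∀ a E r z x → 2 * z ^ E ≤ 2 ^ r → x ≤ 2 ^ (a * r) →
                           2 * (r * (z * x)) ^ E ≤ (2 ^ (E * suc a + 1)) ^ r
configurations-outnumber a E r z x 2zᴱ≤ x≤ = begin
  2 * (r * (z * x)) ^ E       ≡⟨ cong (λ y → 2 * y ^ E) (x∙yz≈y∙xz r z x) ⟩
  2 * (z * (r * x)) ^ E       ≡⟨ cong (2 *_) (^-distribʳ-* z (r * x) E) ⟩
  2 * (z ^ E * (r * x) ^ E)   ≡⟨ sym (*-assoc 2 (z ^ E) _) ⟩
  2 * z ^ E * (r * x) ^ E     ≤⟨ *-mono-≤ 2zᴱ≤ (^-monoˡ-≤ E (*-mono-≤ (<⇒≤ (n<2^n r)) x≤)) ⟩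
  2 ^ r * (2 ^ r * 2 ^ (a * r)) ^ E ≡⟨ cong (λ y → 2 ^ r * y ^ E) (sym (^-distribˡ-+-* 2 r (a * r))) ⟩
  2 ^ r * (2 ^ (r + a * r)) ^ E     ≡⟨ cong (2 ^ r *_) (^-*-assoc 2 (r + a * r) E) ⟩
  2 ^ r * 2 ^ ((r + a * r) * E)     ≡⟨ sym (^-distribˡ-+-* 2 r _) ⟩
  2 ^ (r + (r + a * r) * E)         ≡⟨ cong (2 ^_) (exponents a E r) ⟩
  2 ^ ((E * suc a + 1) * r)         ≡⟨ sym (^-*-assoc 2 (E * suc a + 1) r) ⟩
  (2 ^ (E * suc a + 1)) ^ r ∎
  where
  open ≤-Reasoning
  exponents : ∀ a E r → r + (r + a * r) * E ≡ (E * suc a + 1) * r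
  exponents = solve-∀

exponent-nonZero : ∀ z E r .{{_ : NonZero z}} → 2 * z ^ E ≤ 2 ^ r → NonZero r
exponent-nonZero z E zero    2zᴱ≤1 = contradiction 2zᴱ≤1 (<⇒≱ (*-monoʳ-≤ 2 (m^n>0 z E)))
exponent-nonZero z E (suc r) _     = _

logLowerBound⇒parts : ∀ {A : Pred ℕ 0ℓ} → LogLowerBound A → ∃ λ a → ∀ y →
  ∃ λ x → ∃ λ r → CountAtLeast A x r × y ≤ 2 ^ r × x ≤ 2 ^ (a * r) × NonZero x
logLowerBound⇒parts {A} (a , 1≤a , x₀ , A-dense) = a , witness
  where
  witness : ∀ y → ∃ λ x → ∃ λ r → CountAtLeast A x r × y ≤ 2 ^ r × x ≤ 2 ^ (a * r) × NonZero x
  witness y with A-dense (suc (x₀ + y ^ a)) (m≤n⇒m≤1+n (m≤m+n x₀ _))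
  ... | r , parts , x≤2ᵃʳ = suc (x₀ + y ^ a) , r , parts , y≤2ʳ , x≤2ᵃʳ , _
    where
    y≤2ʳ : y ≤ 2 ^ r
    y≤2ʳ = ^-cancelˡ-≤ a {{>-nonZero 1≤a}} (begin
      y ^ a               ≤⟨ m≤n⇒m≤1+n (m≤n+m (y ^ a) x₀) ⟩
      suc (x₀ + y ^ a)    ≤⟨ x≤2ᵃʳ ⟩
      2 ^ (a * r)         ≡⟨ cong (2 ^_) (*-comm a r) ⟩
      2 ^ (r * a)         ≡⟨ sym (^-*-assoc 2 r a) ⟩
      (2 ^ r) ^ a ∎)
      where open ≤-Reasoning

module Configurations {A M : Pred ℕ 0ℓ} (A-positive : PositiveSet A) (M-positive : PositiveSet M)
  {r} (parts : Fin r → ℕ) (parts-injective : Injective _≡_ _≡_ parts) (parts∈A : ∀ j → A (parts j))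
  {t} (mults : Fin t → ℕ) (mults-injective : Injective _≡_ _≡_ mults) (mults∈M : ∀ i → M (mults i))
  where

  open FiniteSupport {A} M-positive parts parts-injective parts∈A

  -- Configurations c : Fin (t ^ r) stand for the maps Fin r → Fin t via finToFun.
  weights : Fin (t ^ r) → Fin r → ℕ
  weights c = mults ∘ finToFun c

  partitionsAtLeast-fibre : ∀ {K n} (f : Fin K → Fin (t ^ r)) → Injective _≡_ _≡_ f →
                     (∀ i → size (weights (f i)) ≡ n) → PartitionsAtLeast A M n K
  partitionsAtLeast-fibre f f-injective sizes =
    (λ i → partition (weights (f i)) (mults∈M ∘ finToFun (f i)) (sizes i)) ,
    λ i j same → f-injective (finToFun-injective λ l → mults-injective (begin
      weights (f i) l                                ≡⟨ multiplicity-parts (weights (f i)) l ⟨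
      multiplicity (weights (f i)) (parts l)         ≡⟨ same (parts l) ⟩
      multiplicity (weights (f j)) (parts l)         ≡⟨ multiplicity-parts (weights (f j)) l ⟩
      weights (f j) l ∎))
    where open ≡-Reasoning

  many-partitions-of-one-size : ∀ {N z x K} .{{_ : NonZero r}} .{{_ : NonZero K}} →
    (∀ i → N < mults i × mults i ≤ z) → (∀ j → parts j ≤ x) → suc (r * (z * x)) * K ≤ t ^ r →
    ∃ λ n → N < n × n ≤ r * (z * x) × PartitionsAtLeast A M n K
  many-partitions-of-one-size {N} {z} {x} {K} mults-bounds parts≤x enough
    with pigeonhole (size ∘ weights) (r * (z * x)) K
           (λ c → size-≤ (weights c) (proj₂ ∘ mults-bounds ∘ finToFun c) parts≤x) enough
  ... | n , n≤L , f , f-injective , sizes =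
    n , N<n , n≤L , partitionsAtLeast-fibre f f-injective sizes
    where
    c₀ : Fin (t ^ r)
    c₀ = f (fromℕ< (>-nonZero⁻¹ K))
    j₀ : Fin r
    j₀ = fromℕ< (>-nonZero⁻¹ r)
    N<n : N < n
    N<n = <-≤-trans (proj₁ (mults-bounds (finToFun c₀ j₀)))
                    (subst (weights c₀ j₀ ≤_) (sizes _) (weight≤size A-positive (weights c₀) j₀))

mainTheorem2 : (A M : Pred ℕ 0ℓ) → PositiveSet A → PositiveSet M →
    Infinite A → Infinite M → LogLowerBound A →
    ∀ k → 1 ≤ k → ∀ N → ∃ λ n → N < n × PartitionsAtLeast A M n (n ^ k)
mainTheorem2 A M A-positive M-positive _ M-infinite A-log k _ N
  -- A is infinite by the logarithmic bound already, and k = 0 is no harder.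
  with logLowerBound⇒parts {A} A-log
... | a , A-dense
  with distinct-elements-above {M} M-infinite N (2 ^ (suc k * suc a + 1))
... | z , N<z , mults , mults-injective , mults-bounds
  with A-dense (2 * z ^ suc k)
... | x , r , (parts , parts-injective , parts-bounds) , 2zᴱ≤2ʳ , x≤2ᵃʳ , x≢0 =
  conclude (many-partitions-of-one-size (proj₂ ∘ mults-bounds) (proj₂ ∘ parts-bounds) enough)
  where
  open Configurations {A} {M} A-positive M-positive parts (parts-injective _ _) (proj₁ ∘ parts-bounds)
                      mults mults-injective (proj₁ ∘ mults-bounds)
  L : ℕ
  L = r * (z * x)
  instance
    z≢0 : NonZero z
    z≢0 = >-nonZero (<-≤-trans (s≤s z≤n) N<z)
    r≢0 : NonZero r
    r≢0 = exponent-nonZero z (suc k) r 2zᴱ≤2ʳ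
    L≢0 : NonZero L
    L≢0 = m*n≢0 r (z * x) {{r≢0}} {{m*n≢0 z x {{z≢0}} {{x≢0}}}}
    Lᵏ≢0 : NonZero (L ^ k)
    Lᵏ≢0 = m^n≢0 L k
  enough : suc L * L ^ k ≤ (2 ^ (suc k * suc a + 1)) ^ r
  enough = ≤-trans (suc-*-^≤2*-^ L k (>-nonZero⁻¹ L))
                   (configurations-outnumber a (suc k) r z x 2zᴱ≤2ʳ x≤2ᵃʳ)
  conclude : (∃ λ n → N < n × n ≤ L × PartitionsAtLeast A M n (L ^ k)) →
             ∃ λ n → N < n × PartitionsAtLeast A M n (n ^ k)
  conclude (n , N<n , n≤L , partitions) = n , N<n , PartitionsAtLeast-≤ (^-monoˡ-≤ k n≤L) partitions
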